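{- Let $t$ be a plain term with resources and implicit names such that $t:[]$ is derivable in the $\mathcal{L}$-type system described in the context. Then $t$ is closed.
   Context: An ®-index is a pair $(n,\alpha)$ with $n\in\mathbb{N}$ and $\alpha$ a finite string over $\{0,1\}$ ($\varepsilon$ the empty string; $\alpha0,\alpha1$ denote $\alpha$ followed by $0$, resp. $1$). Plain terms: $t::=(n,\alpha)\mid\lambda t\mid t\,t\mid (n,\alpha)\odot t\mid (n,\alpha)\triangledown t$. Strings of booleans are ordered lexicographically from $0<1$ with $\varepsilon$ below every nonempty string, and ®-indices by the lexicographic product of the order on $\mathbb{N}$ and this order. $\mathcal{L}$-types are finite lists of ®-indices. Partial merge $\ddagger$: $[]\ddagger\ell=\ell$; $(x::\ell)\ddagger[]=x::\ell$; $(x_1::\ell_1)\ddagger(x_2::\ell_2)=x_1::(\ell_1\ddagger(x_2::\ell_2))$ if $x_1<x_2$, $=x_2::((x_1::\ell_1)\ddagger\ell_2)$ if $x_2<x_1$, undefined when the recursion reaches equal heads. Partial decrement, defined only on lists whose elements all have strictly positive first component: $\downarrow[]=[]$, $\downarrow((n+1,\alpha)::\ell)=(n,\alpha)::\downarrow\ell$. Typing rules (applicable only when the conclusion's list is defined): $(n,\alpha):[(n,\alpha)]$; if $t:(0,\varepsilon)::\ell$ then $\lambda t:\downarrow\ell$; if $t_1:\ell_1,t_2:\ell_2$ then $t_1t_2:\ell_1\ddagger\ell_2$; if $t:\ell$ then $(n,\alpha)\odot t:[(n,\alpha)]\ddagger\ell$; if $t:\ell\ddagger[(n,\alpha0),(n,\alpha1)]$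 then $(n,\alpha)\triangledown t:[(n,\alpha)]\ddagger\ell$. The multiset $FO(t)$ of free ®-index occurrences: $FO((n,\alpha))=\{(n,\alpha)\}$; $FO(t_1t_2)=FO(t_1)\uplus FO(t_2)$; $FO(\lambda s)=\{(n,\alpha):(n+1,\alpha)\in FO(s)\}$ (occurrences with first component $0$ are bound); $FO((n,\alpha)\odot s)=\{(n,\alpha)\}\uplus FO(s)$; $FO((n,\alpha)\triangledown s)=\{(n,\alpha)\}\uplus(FO(s)$ minus all occurrences of $(n,\alpha0),(n,\alpha1))$. A term $t$ is closed if $FO(t)$ is empty. -}

module Defs where

open import Data.Nat using (ℕ; zero; suc)
open import Data.Bool using (Bool; true; false; if_then_else_; _∨_)
open import Data.List using (List; []; _∷_; _++_; filter)
open import Data.Maybe using (Maybe; just; nothing; _>>=_)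
open import Data.Product using (_×_; _,_; proj₁; proj₂)
open import Relation.Binary.PropositionalEquality using (_≡_)
open import Relation.Nullary.Decidable using (does)
import Data.Nat as ℕ
import Data.Bool as B
import Data.List.Properties as LP
import Data.Product.Properties as PP

-- Strings over {0,1}: 0 = false, 1 = true; ε = [].
BStr : Set
BStr = List Bool

Idx : Set
Idx = ℕ × BStr

_·0 : BStr → BStr
α ·0 = α ++ (false ∷ [])

_·1 : BStr → BStr
α ·1 = α ++ (true ∷ [])

data Term : Set where
  var : Idx → Term
  lam : Term → Term
  app : Term → Term → Term
  res : Idx → Term → Term
  nab : Idx → Term → Term

data Cmp : Set where
  lt eq gt : Cmp

cmpBool : Bool → Bool → Cmp
cmpBool false false = eq
cmpBool false true  = lt
cmpBool true  false = gt
cmpBool true  true  = eq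

cmpStr : BStr → BStr → Cmp
cmpStr []       []       = eq
cmpStr []       (_ ∷ _)  = lt
cmpStr (_ ∷ _)  []       = gt
cmpStr (a ∷ α)  (b ∷ β) with cmpBool a b
... | lt = lt
... | gt = gt
... | eq = cmpStr α β

cmpNat : ℕ → ℕ → Cmp
cmpNat zero    zero    = eq
cmpNat zero    (suc _) = lt
cmpNat (suc _) zero    = gt
cmpNat (suc m) (suc n) = cmpNat m n

cmpIdx : Idx → Idx → Cmp
cmpIdx (m , α) (n , β) with cmpNat m n
... | lt = lt
... | gt = gt
... | eq = cmpStr α β

-- partial merge ‡ (nothing = undefined); the auxiliary function handles
-- the case of a nonempty left list x₁ ∷ ℓ₁, recursing on the right list,
-- with `rec` = merge ℓ₁
mergeAux : Idx → List Idx → (List Idx → Maybe (List Idx)) →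
           List Idx → Maybe (List Idx)
mergeAux x₁ ℓ₁ rec [] = just (x₁ ∷ ℓ₁)
mergeAux x₁ ℓ₁ rec (x₂ ∷ ℓ₂) with cmpIdx x₁ x₂
... | lt = rec (x₂ ∷ ℓ₂) >>= λ r → just (x₁ ∷ r)
... | gt = mergeAux x₁ ℓ₁ rec ℓ₂ >>= λ r → just (x₂ ∷ r)
... | eq = nothing

merge : List Idx → List Idx → Maybe (List Idx)
merge [] ℓ = just ℓ
merge (x₁ ∷ ℓ₁) ℓ₂ = mergeAux x₁ ℓ₁ (merge ℓ₁) ℓ₂

decr : List Idx → Maybe (List Idx)
decr [] = just []
decr ((zero , α) ∷ ℓ) = nothing
decr ((suc n , α) ∷ ℓ) = decr ℓ >>= λ r → just ((n , α) ∷ r)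

infix 4 _⦂_
data _⦂_ : Term → List Idx → Set where
  ty-var : ∀ {x} → var x ⦂ x ∷ []
  ty-lam : ∀ {t ℓ ℓ'} → t ⦂ (0 , []) ∷ ℓ → decr ℓ ≡ just ℓ' → lam t ⦂ ℓ'
  ty-app : ∀ {t₁ t₂ ℓ₁ ℓ₂ ℓ} → t₁ ⦂ ℓ₁ → t₂ ⦂ ℓ₂ → merge ℓ₁ ℓ₂ ≡ just ℓ →
           app t₁ t₂ ⦂ ℓ
  ty-res : ∀ {x t ℓ ℓ'} → t ⦂ ℓ → merge (x ∷ []) ℓ ≡ just ℓ' → res x t ⦂ ℓ'
  ty-nab : ∀ {n α t ℓ ℓ₀ ℓ'} →
           merge ℓ ((n , α ·0) ∷ (n , α ·1) ∷ []) ≡ just ℓ₀ → t ⦂ ℓ₀ →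
           merge ((n , α) ∷ []) ℓ ≡ just ℓ' → nab (n , α) t ⦂ ℓ'

_≟ᵢ_ : (x y : Idx) → Relation.Nullary.Decidable.Dec (x ≡ y)
_≟ᵢ_ = PP.≡-dec ℕ._≟_ (LP.≡-dec B._≟_)

-- multisets of free occurrences, represented as lists
unbind : List Idx → List Idx
unbind [] = []
unbind ((zero , α) ∷ ℓ) = unbind ℓ
unbind ((suc n , α) ∷ ℓ) = (n , α) ∷ unbind ℓ

removeAll : Idx → List Idx → List Idx
removeAll x [] = []
removeAll x (y ∷ ℓ) = if does (x ≟ᵢ y) then removeAll x ℓ else y ∷ removeAll x ℓ

FO : Term → List Idx
FO (var x) = x ∷ []
FO (app t₁ t₂) = FO t₁ ++ FO t₂
FO (lam s) = unbind (FO s)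
FO (res x s) = x ∷ FO s
FO (nab (n , α) s) = (n , α) ∷ removeAll (n , α ·0) (removeAll (n , α ·1) (FO s))

Closed : Term → Set
Closed t = FO t ≡ []

-- A free occurrence of a typed term always survives in its L-type: merging
-- only permutes the two lists, decrementing shifts the free indices exactly
-- as FO does under a binder, and the two indices consumed by (n,α)▽ are
-- exactly the ones FO removes. Hence FO t ⊆ ℓ whenever t ⦂ ℓ, and ℓ = []
-- forces FO t = [].
{-# OPTIONS --safe #-}
module Submission where

open import Defs
open import Data.Nat using (zero; suc)
open import Data.List using ([]; _∷_; _++_)
open import Data.Maybe using (just)
open import Data.Product using (_,_)
open import Data.List.Relation.Unary.Any using (here; there)
open import Data.List.Membership.Propositional using (_∈_)
open import Data.List.Relation.Binary.Subset.Propositional using (_⊆_)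
open import Data.List.Relation.Binary.Subset.Propositional.Properties
  using (⊆-reflexive; ⊆-reflexive-↭; ++⁺; ∷⁺ʳ; ⊆[]⇒≡[])
open import Data.List.Relation.Binary.Permutation.Propositional
  using (_↭_; ↭-refl; ↭-prep; ↭-swap; ↭-sym; ↭-trans)
open import Data.List.Relation.Binary.Permutation.Propositional.Properties
  using (shift; ++-comm; ++-identityʳ)
open import Function using (_∘_)
open import Relation.Nullary using (yes; no; contradiction)
open import Relation.Binary.PropositionalEquality using (_≡_; refl; sym)

mutual
  merge-↭ : ∀ ℓ₁ ℓ₂ {ℓ} → merge ℓ₁ ℓ₂ ≡ just ℓ → ℓ ↭ ℓ₁ ++ ℓ₂
  merge-↭ []        ℓ₂ refl = ↭-refl
  merge-↭ (x₁ ∷ ℓ₁) ℓ₂ e    = mergeAux-↭ x₁ ℓ₁ ℓ₂ e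

  mergeAux-↭ : ∀ x₁ ℓ₁ ℓ₂ {ℓ} → mergeAux x₁ ℓ₁ (merge ℓ₁) ℓ₂ ≡ just ℓ →
               ℓ ↭ x₁ ∷ ℓ₁ ++ ℓ₂
  mergeAux-↭ x₁ ℓ₁ [] refl = ↭-sym (↭-prep x₁ (++-identityʳ ℓ₁))
  mergeAux-↭ x₁ ℓ₁ (x₂ ∷ ℓ₂) e with cmpIdx x₁ x₂
  mergeAux-↭ x₁ ℓ₁ (x₂ ∷ ℓ₂) e | lt with merge ℓ₁ (x₂ ∷ ℓ₂) in e′
  mergeAux-↭ x₁ ℓ₁ (x₂ ∷ ℓ₂) refl | lt | just _ =
    ↭-prep x₁ (merge-↭ ℓ₁ (x₂ ∷ ℓ₂) e′)
  mergeAux-↭ x₁ ℓ₁ (x₂ ∷ ℓ₂) e | gt with mergeAux x₁ ℓ₁ (merge ℓ₁) ℓ₂ in e′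
  mergeAux-↭ x₁ ℓ₁ (x₂ ∷ ℓ₂) refl | gt | just _ =
    ↭-trans (↭-prep x₂ (mergeAux-↭ x₁ ℓ₁ ℓ₂ e′))
            (↭-sym (shift x₂ (x₁ ∷ ℓ₁) ℓ₂))

merge-⊆ : ∀ ℓ₁ ℓ₂ {ℓ} → merge ℓ₁ ℓ₂ ≡ just ℓ → ℓ ⊆ ℓ₁ ++ ℓ₂
merge-⊆ ℓ₁ ℓ₂ = ⊆-reflexive-↭ ∘ merge-↭ ℓ₁ ℓ₂

merge-⊇ : ∀ ℓ₁ ℓ₂ {ℓ} → merge ℓ₁ ℓ₂ ≡ just ℓ → ℓ₁ ++ ℓ₂ ⊆ ℓ
merge-⊇ ℓ₁ ℓ₂ = ⊆-reflexive-↭ ∘ ↭-sym ∘ merge-↭ ℓ₁ ℓ₂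

∈-unbind⁺ : ∀ {n α} L → (suc n , α) ∈ L → (n , α) ∈ unbind L
∈-unbind⁺ ((suc _ , _) ∷ L) (here refl) = here refl
∈-unbind⁺ ((zero  , _) ∷ L) (there p)   = ∈-unbind⁺ L p
∈-unbind⁺ ((suc _ , _) ∷ L) (there p)   = there (∈-unbind⁺ L p)

∈-unbind⁻ : ∀ {n α} L → (n , α) ∈ unbind L → (suc n , α) ∈ L
∈-unbind⁻ ((zero  , _) ∷ L) p           = there (∈-unbind⁻ L p)
∈-unbind⁻ ((suc _ , _) ∷ L) (here refl) = here refl
∈-unbind⁻ ((suc _ , _) ∷ L) (there p)   = there (∈-unbind⁻ L p)

unbind-⊆ : ∀ {L M} → L ⊆ M → unbind L ⊆ unbind M
unbind-⊆ {L} {M} L⊆M {_ , _} = ∈-unbind⁺ M ∘ L⊆M ∘ ∈-unbind⁻ L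

decr⇒unbind : ∀ ℓ {ℓ′} → decr ℓ ≡ just ℓ′ → unbind ℓ ≡ ℓ′
decr⇒unbind [] refl = refl
decr⇒unbind ((suc n , α) ∷ ℓ) e with decr ℓ in e′
decr⇒unbind ((suc n , α) ∷ ℓ) refl | just _ rewrite decr⇒unbind ℓ e′ = refl

removeAll-⊆ : ∀ {y ℓ} L → L ⊆ y ∷ ℓ → removeAll y L ⊆ ℓ
removeAll-⊆ {y} (z ∷ L) L⊆ p with y ≟ᵢ z
... | yes _ = removeAll-⊆ L (L⊆ ∘ there) p
removeAll-⊆ (z ∷ L) L⊆ (here refl) | no y≢z with L⊆ (here refl)
... | here z≡y  = contradiction (sym z≡y) y≢z
... | there z∈ℓ = z∈ℓ
removeAll-⊆ (z ∷ L) L⊆ (there p) | no _ = removeAll-⊆ L (L⊆ ∘ there) p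

FO-⊆ : ∀ {t ℓ} → t ⦂ ℓ → FO t ⊆ ℓ
FO-⊆ ty-var = λ p → p
-- unbind drops the bound head (0 , ε) of the premise's type definitionally.
FO-⊆ {lam t} (ty-lam {ℓ = ℓ} d e) =
  ⊆-reflexive (decr⇒unbind ℓ e) ∘ unbind-⊆ (FO-⊆ d)
FO-⊆ (ty-app {ℓ₁ = ℓ₁} {ℓ₂} d₁ d₂ e) = merge-⊇ ℓ₁ ℓ₂ e ∘ ++⁺ (FO-⊆ d₁) (FO-⊆ d₂)
FO-⊆ (ty-res {x = x} {ℓ = ℓ} d e) = merge-⊇ (x ∷ []) ℓ e ∘ ∷⁺ʳ x (FO-⊆ d)
FO-⊆ {nab (n , α) t} (ty-nab {ℓ = ℓ} e₀ d e) =
  merge-⊇ ((n , α) ∷ []) ℓ e ∘ ∷⁺ʳ (n , α) (removeAll-⊆ _ (removeAll-⊆ (FO t) FOt⊆))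
  where
  reorder : ℓ ++ (n , α ·0) ∷ (n , α ·1) ∷ [] ↭ (n , α ·1) ∷ (n , α ·0) ∷ ℓ
  reorder = ↭-trans (++-comm ℓ _) (↭-swap _ _ ↭-refl)

  FOt⊆ : FO t ⊆ (n , α ·1) ∷ (n , α ·0) ∷ ℓ
  FOt⊆ = ⊆-reflexive-↭ reorder ∘ merge-⊆ ℓ _ e₀ ∘ FO-⊆ d

proposition5 : (t : Term) → t ⦂ [] → Closed t
proposition5 t d = ⊆[]⇒≡[] (FO-⊆ d)
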